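{- Let $A$ be a generalized Latin square of order $n$ in which every symbol occurs either exactly once or exactly $n$ times, and suppose both multiplicities $1$ and $n$ occur. Then $A$ has a transversal.
   Context: A generalized Latin square of order $n$ is an $n\times n$ matrix whose entries are symbols, each symbol appearing at most once in each row and at most once in each column. A transversal is a set of $n$ entries, one in each row and one in each column, whose symbols are pairwise distinct. -}

module Defs where

open import Data.Nat using (ℕ; _≟_)
open import Data.Fin using (Fin)
open import Data.Product using (_×_; Σ; ∃; ∃-syntax)
open import Data.Sum using (_⊎_)
open import Data.Nat.ListAction using (sum)
open import Data.List using (List; map; allFin)
open import Relation.Nullary.Decidable using (⌊_⌋)
open import Data.Bool using (Bool; if_then_else_)
open import Relation.Binary.PropositionalEquality using (_≡_; _≢_)
open import Data.Fin.Permutation using (Permutation′; _⟨$⟩ʳ_)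
open import Function.Definitions using (Injective)

Square : ℕ → Set
Square n = Fin n → Fin n → ℕ

IsGenLatin : {n : ℕ} → Square n → Set
IsGenLatin {n} A =
  (∀ i j k → A i j ≡ A i k → j ≡ k) × (∀ i j k → A i k ≡ A j k → i ≡ j)

occ : {n : ℕ} → Square n → ℕ → ℕ
occ {n} A s =
  sum (map (λ i → sum (map (λ j → if ⌊ A i j ≟ s ⌋ then 1 else 0) (allFin n))) (allFin n))

Occurs : {n : ℕ} → Square n → ℕ → Set
Occurs {n} A s = ∃[ i ] ∃[ j ] A i j ≡ s

HasTransversal : {n : ℕ} → Square n → Set
HasTransversal {n} A =
  Σ (Permutation′ n) λ σ → Injective _≡_ _≡_ (λ (i : Fin n) → A i (σ ⟨$⟩ʳ i))

module Submission where

-- Call a cell a singleton cell if its symbol occurs only once, and view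
-- the singleton cells as a bipartite graph between rows and columns. A symbol
-- occurring n times occurs once in every row and every column, so each row and
-- each column contains as many non-singleton cells as there are such symbols;
-- hence the graph is d-regular, and d ≥ 1 because a singleton cell exists. A
-- d-regular bipartite graph satisfies Hall's condition (double counting), so it
-- has a perfect matching, i.e. a permutation σ with every cell (i , σ i) a
-- singleton cell. Distinct singleton cells carry distinct symbols, so these n
-- cells form a transversal.

open import Defs
open import Data.Nat using (ℕ)
open import Data.Product using (_×_; ∃-syntax)
open import Data.Sum using (_⊎_)
open import Relation.Binary.PropositionalEquality using (_≡_)

open import Data.Bool using (Bool; true; false; T; not; _∧_; _∨_; if_then_else_)
open import Data.Bool.Properties using (T?; T-∧; T-∨)
open import Data.Empty using (⊥-elim)
open import Data.Fin as Fin using (Fin; zero; suc; punchOut)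
open import Data.Fin.Permutation using (Permutation′)
open import Data.Fin.Properties using (any?; all?; suc-injective; punchOut-injective; injective⇒≤)
open import Data.Fin.Subset.Properties using (anySubset?)
import Data.List as List
open import Data.List.Properties using (map-tabulate)
open import Data.Nat as ℕ using (zero; suc; _+_; _*_; _≤_; _<_; z≤n; s≤s⁻¹; NonZero; >-nonZero)
open import Data.Nat.Induction using (<-wellFounded)
open import Data.Nat.ListAction using () renaming (sum to list-sum)
open import Data.Nat.Properties
  using (≤-refl; ≤-trans; ≤-reflexive; ≤-antisym; +-comm; +-mono-≤; +-monoˡ-≤; +-identityʳ;
         +-cancelʳ-≡; +-cancelˡ-≤; *-cancelʳ-≤; n≤0⇒n≡0; <⇒≢; ≰⇒>; m≤m+n; m≤n+m; 1+n≰n;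
         +-*-semiring; module ≤-Reasoning)
open import Data.Product using (∃; _,_; proj₁; proj₂)
open import Data.Sum using (inj₁; inj₂)
open import Data.Unit using (tt)
open import Data.Vec using (lookup; tabulate)
open import Data.Vec.Properties using (lookup∘tabulate)
open import Function using (_∘_; id; case_of_; Equivalence)
open import Function.Bundles using (mk↔ₛ′)
open import Function.Definitions using (Injective)
open import Induction.WellFounded using (Acc; acc)
open import Relation.Binary.PropositionalEquality
  using (_≢_; refl; sym; trans; cong; subst; module ≡-Reasoning)
open import Relation.Nullary using (¬_; yes; no; Dec; contradiction)
open import Relation.Nullary.Decidable
  using (⌊_⌋; map′; ⌊⌋-map′; toWitness; fromWitness; _×-dec_; _→-dec_; ¬?)

open import Algebra.Properties.Semiring.Sum +-*-semiring
  using (sum; sum-cong-≗; ∑-comm; ∑-distrib-+; *-distribʳ-sum; sum-replicate-zero)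

private
  variable
    m n : ℕ

ind : Bool → ℕ
ind b = if b then 1 else 0

T-not⇒¬T : ∀ b → T (not b) → ¬ T b
T-not⇒¬T true () _
T-not⇒¬T false _ ()

¬T⇒T-not : ∀ b → ¬ T b → T (not b)
¬T⇒T-not true ¬b = ¬b tt
¬T⇒T-not false _ = tt

Sub : ℕ → Set
Sub n = Fin n → Bool

infix 4 _∈_ _∉_ _⊆_
infixr 7 _∩_
infixr 6 _∪_ _─_

-- Membership, wrapped in a record so that Agda can infer x and S from x ∈ S.
record _∈_ (x : Fin n) (S : Sub n) : Set where
  constructor mem
  field holds : T (S x)
open _∈_

_∉_ : Fin n → Sub n → Set
x ∉ S = ¬ x ∈ S

_⊆_ : Sub n → Sub n → Set
S ⊆ R = ∀ x → x ∈ S → x ∈ R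

∅ full : Sub n
∅ _ = false
full _ = true

⁅_⁆ : Fin n → Sub n
⁅ x ⁆ y = ⌊ x Fin.≟ y ⌋

_∩_ _∪_ _─_ : Sub n → Sub n → Sub n
(S ∩ R) x = S x ∧ R x
(S ∪ R) x = S x ∨ R x
(S ─ R) x = S x ∧ not (R x)

_∈?_ : (x : Fin n) (S : Sub n) → Dec (x ∈ S)
x ∈? S = map′ mem holds (T? (S x))

nonempty : Sub n → Bool
nonempty S = ⌊ any? (_∈? S) ⌋

private
  variable
    S R : Sub n
    x y : Fin n

∩-intro : x ∈ S → x ∈ R → x ∈ S ∩ R
∩-intro (mem p) (mem q) = mem (Equivalence.from T-∧ (p , q))

∩-elimˡ : x ∈ S ∩ R → x ∈ S
∩-elimˡ (mem p) = mem (proj₁ (Equivalence.to T-∧ p))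

∩-elimʳ : x ∈ S ∩ R → x ∈ R
∩-elimʳ (mem p) = mem (proj₂ (Equivalence.to T-∧ p))

∪-introˡ : x ∈ S → x ∈ S ∪ R
∪-introˡ (mem p) = mem (Equivalence.from T-∨ (inj₁ p))

∪-introʳ : x ∈ R → x ∈ S ∪ R
∪-introʳ (mem p) = mem (Equivalence.from T-∨ (inj₂ p))

∪-elim : x ∈ S ∪ R → x ∈ S ⊎ x ∈ R
∪-elim (mem p) with Equivalence.to T-∨ p
... | inj₁ q = inj₁ (mem q)
... | inj₂ q = inj₂ (mem q)

─-intro : x ∈ S → x ∉ R → x ∈ S ─ R
─-intro {x = x} {R = R} p q = ∩-intro p (mem (¬T⇒T-not (R x) (q ∘ mem)))

─-elimˡ : x ∈ S ─ R → x ∈ S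
─-elimˡ = ∩-elimˡ

─-elimʳ : x ∈ S ─ R → x ∉ R
─-elimʳ {x = x} {R = R} (mem p) (mem q) = T-not⇒¬T (R x) (proj₂ (Equivalence.to T-∧ p)) q

⁅⁆-intro : (x : Fin n) → x ∈ ⁅ x ⁆
⁅⁆-intro x = mem (fromWitness refl)

⁅⁆-elim : y ∈ ⁅ x ⁆ → x ≡ y
⁅⁆-elim (mem p) = toWitness p

nonempty-intro : x ∈ S → T (nonempty S)
nonempty-intro {x = x} p = fromWitness (x , p)

nonempty-elim : T (nonempty S) → ∃ λ x → x ∈ S
nonempty-elim = toWitness

AtMostOne : Sub n → Set
AtMostOne S = ∀ x y → x ∈ S → y ∈ S → x ≡ y

sum-mono : (f g : Fin n → ℕ) → (∀ i → f i ≤ g i) → sum f ≤ sum g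
sum-mono {zero} f g f≤g = z≤n
sum-mono {suc n} f g f≤g = +-mono-≤ (f≤g zero) (sum-mono (f ∘ suc) (g ∘ suc) (f≤g ∘ suc))

term≤sum : (f : Fin n → ℕ) (i : Fin n) → f i ≤ sum f
term≤sum f zero = m≤m+n _ _
term≤sum f (suc i) = ≤-trans (term≤sum (f ∘ suc) i) (m≤n+m _ _)

ind-∈ : ∀ b → T b → ind b ≡ 1
ind-∈ true _ = refl

ind-∉ : ∀ b → ¬ T b → ind b ≡ 0
ind-∉ true ¬b = ⊥-elim (¬b tt)
ind-∉ false _ = refl

ind-mono : ∀ a b → (T a → T b) → ind a ≤ ind b
ind-mono false _ _ = z≤n
ind-mono true true _ = ≤-refl
ind-mono true false a⇒b = ⊥-elim (a⇒b tt)

-- Cardinality of a subset of Fin n. It is kept opaque: everything below uses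
-- it only through the lemmas of this block, and Agda can then infer S from ∣ S ∣.
opaque
  ∣_∣ : Sub n → ℕ
  ∣ S ∣ = sum (λ x → ind (S x))

  ∣∣-as-sum : (S : Sub n) → ∣ S ∣ ≡ sum (λ x → ind (S x))
  ∣∣-as-sum S = refl

  ∣∣-*-as-sum : (S : Sub n) (d : ℕ) → ∣ S ∣ * d ≡ sum (λ x → ind (S x) * d)
  ∣∣-*-as-sum S d = *-distribʳ-sum d (λ x → ind (S x))

  double-count : (F : Fin m → Fin n → Bool) → sum (λ i → ∣ F i ∣) ≡ sum (λ j → ∣ (λ i → F i j) ∣)
  double-count F = ∑-comm (λ i j → ind (F i j))

  ∣∣-suc : (S : Sub (suc n)) → ∣ S ∣ ≡ ind (S zero) + ∣ S ∘ suc ∣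
  ∣∣-suc S = refl

  ∣∣-mono : S ⊆ R → ∣ S ∣ ≤ ∣ R ∣
  ∣∣-mono {S = S} {R = R} S⊆R =
    sum-mono _ _ (λ x → ind-mono (S x) (R x) (holds ∘ S⊆R x ∘ mem))

  ∣∣-pos : x ∈ S → 1 ≤ ∣ S ∣
  ∣∣-pos {x = x} {S = S} (mem p) =
    ≤-trans (ind-mono true (S x) (λ _ → p)) (term≤sum (λ y → ind (S y)) x)

  ∣∅∣ : ∀ n → ∣ ∅ {n} ∣ ≡ 0
  ∣∅∣ n = sum-replicate-zero n

  ∣full∣ : ∣ full {n} ∣ ≡ n
  ∣full∣ {zero} = refl
  ∣full∣ {suc n} = cong suc ∣full∣

  ∣⁅⁆∣ : (x : Fin n) → ∣ ⁅ x ⁆ ∣ ≡ 1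
  ∣⁅⁆∣ {suc n} zero = cong suc (∣∅∣ n)
  ∣⁅⁆∣ (suc x) = trans (sum-cong-≗ (λ y → cong ind (⌊⌋-map′ _ _ (x Fin.≟ y)))) (∣⁅⁆∣ x)

  ∣∣-split : (P : Sub n) → ∣ S ∣ ≡ ∣ S ∩ P ∣ + ∣ S ─ P ∣
  ∣∣-split {S = S} P = trans (sum-cong-≗ (λ x → ind-split (S x) (P x)))
                             (∑-distrib-+ (λ x → ind (S x ∧ P x)) (λ x → ind (S x ∧ not (P x))))
    where
    ind-split : ∀ a b → ind a ≡ ind (a ∧ b) + ind (a ∧ not b)
    ind-split true true = refl
    ind-split true false = refl
    ind-split false _ = refl

  ind-*-∣∣ : ∀ b (R : Sub n) → ind b * ∣ R ∣ ≡ ∣ (λ x → b ∧ R x) ∣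
  ind-*-∣∣ true R = +-identityʳ ∣ R ∣
  ind-*-∣∣ {n} false R = sym (∣∅∣ n)

∣∣-empty : {S : Sub n} → (∀ x → x ∉ S) → ∣ S ∣ ≡ 0
∣∣-empty {n = n} ¬S = n≤0⇒n≡0 (≤-trans (∣∣-mono (λ x p → ⊥-elim (¬S x p))) (≤-reflexive (∣∅∣ n)))

∣∣-witness : 1 ≤ ∣ S ∣ → ∃ λ x → x ∈ S
∣∣-witness {S = S} pos with any? (_∈? S)
... | yes found = found
... | no none with () ← subst (1 ≤_) (∣∣-empty (λ x p → none (x , p))) pos

∣∣+∣∁∣ : (S : Sub n) → ∣ S ∣ + ∣ full ─ S ∣ ≡ n
∣∣+∣∁∣ S = trans (sym (∣∣-split {S = full} S)) ∣full∣

∣∣-mono-< : S ⊆ R → x ∈ R → x ∉ S → ∣ S ∣ < ∣ R ∣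
∣∣-mono-< {S = S} {R = R} S⊆R x∈R x∉S = begin
  suc ∣ S ∣              ≡⟨ +-comm 1 ∣ S ∣ ⟩
  ∣ S ∣ + 1              ≤⟨ +-mono-≤ (∣∣-mono S⊆R∩S) (∣∣-pos (─-intro x∈R x∉S)) ⟩
  ∣ R ∩ S ∣ + ∣ R ─ S ∣  ≡⟨ sym (∣∣-split S) ⟩
  ∣ R ∣                  ∎
  where
  open ≤-Reasoning
  S⊆R∩S : S ⊆ R ∩ S
  S⊆R∩S y p = ∩-intro (S⊆R y p) p

∣∣≡n⇒full : {S : Sub n} → ∣ S ∣ ≡ n → ∀ x → x ∈ S
∣∣≡n⇒full {S = S} size x with x ∈? S
... | yes x∈S = x∈S
... | no x∉S = contradiction (trans size (sym ∣full∣))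
                             (<⇒≢ (∣∣-mono-< (λ _ _ → mem tt) (mem tt) x∉S))

∣∣-atMostOne : AtMostOne S → ∣ S ∣ ≡ ind (nonempty S)
∣∣-atMostOne {S = S} unique with any? (_∈? S)
... | no none = ∣∣-empty (λ x p → none (x , p))
... | yes (x , x∈S) = ≤-antisym (≤-trans (∣∣-mono S⊆⁅x⁆) (≤-reflexive (∣⁅⁆∣ x))) (∣∣-pos x∈S)
  where
  S⊆⁅x⁆ : S ⊆ ⁅ x ⁆
  S⊆⁅x⁆ y y∈S = subst (_∈ ⁅ x ⁆) (unique x y x∈S y∈S) (⁅⁆-intro x)

∣∣≤1⇒atMostOne : ∣ S ∣ ≤ 1 → AtMostOne S
∣∣≤1⇒atMostOne {S = S} size x y x∈S y∈S with x Fin.≟ y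
... | yes x≡y = x≡y
... | no x≢y = contradiction two≤∣S∣ (λ le → 1+n≰n (≤-trans le size))
  where
  two≤∣S∣ : 2 ≤ ∣ S ∣
  two≤∣S∣ = ≤-trans
    (+-mono-≤ (∣∣-pos (∩-intro x∈S (⁅⁆-intro x))) (∣∣-pos (─-intro y∈S (x≢y ∘ ⁅⁆-elim))))
    (≤-reflexive (sym (∣∣-split ⁅ x ⁆)))

∣∣-injection : (S : Sub m) (R : Sub n) (f : ∀ x → x ∈ S → Fin n) →
  (∀ x p → f x p ∈ R) → (∀ x y p q → f x p ≡ f y q → x ≡ y) → ∣ S ∣ ≤ ∣ R ∣
∣∣-injection {zero} S R f into inj = ≤-trans (≤-reflexive (∣∣-empty (λ ()))) z≤n
∣∣-injection {suc m} S R f into inj = by-cases (zero ∈? S)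
  where
  shift : x ∈ S ∘ suc → suc x ∈ S
  shift (mem p) = mem p

  f′ : ∀ x → x ∈ S ∘ suc → Fin _
  f′ x p = f (suc x) (shift p)

  rest : ∀ R′ → (∀ x p → f′ x p ∈ R′) → ∣ S ∘ suc ∣ ≤ ∣ R′ ∣
  rest R′ into′ = ∣∣-injection (S ∘ suc) R′ f′ into′
                    (λ x y p q → suc-injective ∘ inj _ _ (shift p) (shift q))

  by-cases : Dec (zero ∈ S) → ∣ S ∣ ≤ ∣ R ∣
  by-cases (no 0∉S) = begin
    ∣ S ∣         ≡⟨ trans (∣∣-suc S) (cong (_+ ∣ S ∘ suc ∣) (ind-∉ (S zero) (0∉S ∘ mem))) ⟩
    ∣ S ∘ suc ∣   ≤⟨ rest R (λ x p → into (suc x) (shift p)) ⟩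
    ∣ R ∣         ∎
    where open ≤-Reasoning
  -- f (suc x) avoids the column c = f zero, so the tail maps into R ─ ⁅ c ⁆.
  by-cases (yes 0∈S) = begin
    ∣ S ∣                          ≡⟨ trans (∣∣-suc S) (cong (_+ ∣ S ∘ suc ∣) (ind-∈ (S zero) (holds 0∈S))) ⟩
    1 + ∣ S ∘ suc ∣                ≤⟨ +-mono-≤ (∣∣-pos c∈R∩c) (rest (R ─ ⁅ c ⁆) avoid-c) ⟩
    ∣ R ∩ ⁅ c ⁆ ∣ + ∣ R ─ ⁅ c ⁆ ∣  ≡⟨ sym (∣∣-split ⁅ c ⁆) ⟩
    ∣ R ∣                          ∎
    where
    open ≤-Reasoning
    c : Fin _
    c = f zero 0∈S
    c∈R∩c : c ∈ R ∩ ⁅ c ⁆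
    c∈R∩c = ∩-intro (into zero 0∈S) (⁅⁆-intro c)
    avoid-c : ∀ x p → f′ x p ∈ R ─ ⁅ c ⁆
    avoid-c x p = ─-intro (into (suc x) (shift p))
                          (λ c∈ → case inj _ _ 0∈S (shift p) (⁅⁆-elim c∈) of λ ())

∣∣-gated : {S : Sub n} {k : ℕ} → ∣ S ∣ ≤ k → ∣ S ∣ ≤ ind (nonempty S) * k
∣∣-gated {S = S} {k} bound with any? (_∈? S)
... | yes _ = subst (∣ S ∣ ≤_) (sym (+-identityʳ k)) bound
... | no none = ≤-reflexive (∣∣-empty (λ x p → none (x , p)))

-- Hall's marriage theorem for a bipartite relation E between rows Fin m and
-- columns Fin n, in the relative form needed for the induction: rows R may be
-- matched into columns C whenever every S ⊆ R has at least ∣ S ∣ neighbours in C.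
module Hall {m n : ℕ} (E : Fin m → Fin n → Bool) where

  column : Fin n → Sub m
  column c i = E i c

  Γ : Sub m → Sub n
  Γ S c = nonempty (S ∩ column c)

  Γ-intro : {S : Sub m} {i : Fin m} {c : Fin n} → i ∈ S → T (E i c) → c ∈ Γ S
  Γ-intro {c = c} i∈S e = mem (nonempty-intro (∩-intro i∈S (mem {S = column c} e)))

  Γ-elim : {S : Sub m} {c : Fin n} → c ∈ Γ S → ∃ λ i → i ∈ S × T (E i c)
  Γ-elim {S} {c} (mem p) with nonempty-elim {S = S ∩ column c} p
  ... | i , q = i , ∩-elimˡ q , holds (∩-elimʳ {S = S} q)

  Γ-mono : {S S′ : Sub m} → S ⊆ S′ → Γ S ⊆ Γ S′
  Γ-mono S⊆S′ c c∈ΓS with Γ-elim c∈ΓS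
  ... | i , i∈S , e = Γ-intro (S⊆S′ i i∈S) e

  HallCondition : Sub m → Sub n → Set
  HallCondition R C = ∀ S → S ⊆ R → ∣ S ∣ ≤ ∣ Γ S ∩ C ∣

  record Matching (R : Sub m) (C : Sub n) : Set where
    field
      partner   : ∀ i → i ∈ R → Fin n
      adjacent  : ∀ i p → T (E i (partner i p))
      lands     : ∀ i p → partner i p ∈ C
      injective : ∀ i j p q → partner i p ≡ partner j q → i ≡ j

  hall-mono : {R R′ : Sub m} {C : Sub n} → R′ ⊆ R → HallCondition R C → HallCondition R′ C
  hall-mono R′⊆R hall S S⊆R′ = hall S (λ x → R′⊆R x ∘ S⊆R′ x)

  empty-matching : {R : Sub m} {C : Sub n} → (∀ i → i ∉ R) → Matching R C
  empty-matching noRow = record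
    { partner = λ i p → ⊥-elim (noRow i p)
    ; adjacent = λ i p → ⊥-elim (noRow i p)
    ; lands = λ i p → ⊥-elim (noRow i p)
    ; injective = λ i _ p _ _ → ⊥-elim (noRow i p)
    }

  edge-matching : {R : Sub m} (r : Fin m) (c : Fin n) → T (E r c) → Matching (R ∩ ⁅ r ⁆) ⁅ c ⁆
  edge-matching r c e = record
    { partner = λ _ _ → c
    ; adjacent = λ i p → subst (λ i → T (E i c)) (is-r p) e
    ; lands = λ _ _ → ⁅⁆-intro c
    ; injective = λ i j p q _ → trans (sym (is-r p)) (is-r q)
    }
    where
    is-r : ∀ {i} → i ∈ _ ∩ ⁅ r ⁆ → r ≡ i
    is-r = ⁅⁆-elim ∘ ∩-elimʳ

  narrow : {R R′ : Sub m} {C : Sub n} → R′ ⊆ R → Matching R C → Matching R′ (Γ R ∩ C)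
  narrow R′⊆R M = record
    { partner = λ i p → partner i (R′⊆R i p)
    ; adjacent = λ i p → adjacent i (R′⊆R i p)
    ; lands = λ i p → ∩-intro (Γ-intro (R′⊆R i p) (adjacent i _)) (lands i _)
    ; injective = λ i j p q → injective i j _ _
    }
    where open Matching M

  glue : {R : Sub m} {C : Sub n} (P : Sub m) (C₁ : Sub n) → C₁ ⊆ C →
    Matching (R ∩ P) C₁ → Matching (R ─ P) (C ─ C₁) → Matching R C
  glue {R} {C} P C₁ C₁⊆C M₁ M₂ = record
    { partner = λ i p → pick i (side i p)
    ; adjacent = λ i p → pick-adjacent i (side i p)
    ; lands = λ i p → pick-lands i (side i p)
    ; injective = λ i j p q → pick-injective i j (side i p) (side j q)
    }
    where
    module M₁ = Matching M₁
    module M₂ = Matching M₂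

    Side : Fin m → Set
    Side i = i ∈ R ∩ P ⊎ i ∈ R ─ P

    side : ∀ i → i ∈ R → Side i
    side i p with i ∈? P
    ... | yes q = inj₁ (∩-intro p q)
    ... | no q = inj₂ (─-intro p q)

    pick : ∀ i → Side i → Fin n
    pick i (inj₁ q) = M₁.partner i q
    pick i (inj₂ q) = M₂.partner i q

    pick-adjacent : ∀ i s → T (E i (pick i s))
    pick-adjacent i (inj₁ q) = M₁.adjacent i q
    pick-adjacent i (inj₂ q) = M₂.adjacent i q

    pick-lands : ∀ i s → pick i s ∈ C
    pick-lands i (inj₁ q) = C₁⊆C _ (M₁.lands i q)
    pick-lands i (inj₂ q) = ─-elimˡ (M₂.lands i q)

    disjoint : ∀ i j p q → M₁.partner i p ≢ M₂.partner j q
    disjoint i j p q e = ─-elimʳ (M₂.lands j q) (subst (_∈ C₁) e (M₁.lands i p))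

    pick-injective : ∀ i j s t → pick i s ≡ pick j t → i ≡ j
    pick-injective i j (inj₁ p) (inj₁ q) = M₁.injective i j p q
    pick-injective i j (inj₂ p) (inj₂ q) = M₂.injective i j p q
    pick-injective i j (inj₁ p) (inj₂ q) = ⊥-elim ∘ disjoint i j p q
    pick-injective i j (inj₂ p) (inj₁ q) = ⊥-elim ∘ disjoint j i q p ∘ sym

  Critical : Sub m → Sub n → Sub m → Set
  Critical R C S = S ⊆ R × (∃ λ x → x ∈ S) × (∃ λ y → y ∈ R × y ∉ S) × ∣ Γ S ∩ C ∣ ≤ ∣ S ∣

  critical-resp : {R S S′ : Sub m} {C : Sub n} → S ⊆ S′ → S′ ⊆ S → Critical R C S → Critical R C S′
  critical-resp S⊆S′ S′⊆S (S⊆R , (x , x∈S) , (y , y∈R , y∉S) , tight) =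
    (λ z → S⊆R z ∘ S′⊆S z) , (x , S⊆S′ x x∈S) , (y , y∈R , y∉S ∘ S′⊆S y) ,
    ≤-trans (∣∣-mono (λ c p → ∩-intro (Γ-mono S′⊆S c (∩-elimˡ p)) (∩-elimʳ p)))
            (≤-trans tight (∣∣-mono S⊆S′))

  critical? : (R : Sub m) (C : Sub n) → Dec (∃ (Critical R C))
  critical? R C with anySubset? (λ s → isCritical? (lookup s))
    where
    isCritical? : ∀ S → Dec (Critical R C S)
    isCritical? S = all? (λ x → x ∈? S →-dec x ∈? R) ×-dec any? (_∈? S)
      ×-dec any? (λ y → y ∈? R ×-dec ¬? (y ∈? S)) ×-dec ∣ Γ S ∩ C ∣ ℕ.≤? ∣ S ∣
  ... | yes (s , crit) = yes (lookup s , crit)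
  ... | no none = no λ (S , crit) → none (tabulate S , critical-resp (into S) (from S) crit)
    where
    into : ∀ S → S ⊆ lookup (tabulate S)
    into S x (mem p) = mem (subst T (sym (lookup∘tabulate S x)) p)
    from : ∀ S → lookup (tabulate S) ⊆ S
    from S x (mem p) = mem (subst T (lookup∘tabulate S x) p)

  -- Matchings exist for every row set smaller than R (the induction hypothesis).
  Smaller : Sub m → Set
  Smaller R = ∀ R′ C′ → ∣ R′ ∣ < ∣ R ∣ → HallCondition R′ C′ → Matching R′ C′

  -- Without critical sets, deleting a row r and a column c keeps Hall's condition:
  -- every nonempty T ⊆ R ─ ⁅ r ⁆ has a surplus neighbour in C, so one in C ─ ⁅ c ⁆.
  hall-delete : {R : Sub m} {C : Sub n} {r : Fin m} (c : Fin n) → HallCondition R C →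
    ¬ ∃ (Critical R C) → r ∈ R → HallCondition (R ─ ⁅ r ⁆) (C ─ ⁅ c ⁆)
  hall-delete {R} {C} {r} c hall noCritical r∈R T T⊆ with any? (_∈? T)
  ... | no none = ≤-trans (≤-reflexive (∣∣-empty (λ x p → none (x , p)))) z≤n
  ... | yes x∈T = s≤s⁻¹ (begin
    suc ∣ T ∣                                  ≤⟨ surplus ⟩
    ∣ Γ T ∩ C ∣                                ≡⟨ ∣∣-split ⁅ c ⁆ ⟩
    ∣ (Γ T ∩ C) ∩ ⁅ c ⁆ ∣ + ∣ (Γ T ∩ C) ─ ⁅ c ⁆ ∣ ≤⟨ +-mono-≤ at-most-c without-c ⟩
    1 + ∣ Γ T ∩ (C ─ ⁅ c ⁆) ∣                  ∎)
    where
    open ≤-Reasoning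
    T⊆R : T ⊆ R
    T⊆R x = ─-elimˡ ∘ T⊆ x
    r∉T : r ∉ T
    r∉T r∈T = ─-elimʳ (T⊆ r r∈T) (⁅⁆-intro r)
    surplus : ∣ T ∣ < ∣ Γ T ∩ C ∣
    surplus = ≰⇒> (λ tight → noCritical (T , T⊆R , x∈T , (r , r∈R , r∉T) , tight))
    at-most-c : ∣ (Γ T ∩ C) ∩ ⁅ c ⁆ ∣ ≤ 1
    at-most-c = ≤-trans (∣∣-mono (λ _ → ∩-elimʳ)) (≤-reflexive (∣⁅⁆∣ c))
    without-c : ∣ (Γ T ∩ C) ─ ⁅ c ⁆ ∣ ≤ ∣ Γ T ∩ (C ─ ⁅ c ⁆) ∣
    without-c = ∣∣-mono shrink
      where
      shrink : (Γ T ∩ C) ─ ⁅ c ⁆ ⊆ Γ T ∩ (C ─ ⁅ c ⁆)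
      shrink d p = ∩-intro (∩-elimˡ {R = C} d∈ΓT∩C) (─-intro (∩-elimʳ {S = Γ T} d∈ΓT∩C) (─-elimʳ p))
        where
        d∈ΓT∩C : d ∈ Γ T ∩ C
        d∈ΓT∩C = ─-elimˡ p

  -- No critical set: match some row r to an adjacent column c ∈ C, and the rest
  -- by induction after deleting r and c.
  match-noncritical : {R : Sub m} {C : Sub n} {r : Fin m} → HallCondition R C → Smaller R →
    ¬ ∃ (Critical R C) → r ∈ R → Matching R C
  match-noncritical {R} {C} {r} hall smaller noCritical r∈R =
    glue ⁅ r ⁆ ⁅ c ⁆ (λ d p → subst (_∈ C) (⁅⁆-elim p) c∈C) (edge-matching r c rc)
      (smaller _ _ (∣∣-mono-< (λ _ → ─-elimˡ) r∈R (λ p → ─-elimʳ p (⁅⁆-intro r)))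
                   (hall-delete c hall noCritical r∈R))
    where
    r⊆R : ⁅ r ⁆ ⊆ R
    r⊆R x p = subst (_∈ R) (⁅⁆-elim p) r∈R
    neighbour : ∃ λ c → c ∈ Γ ⁅ r ⁆ ∩ C
    neighbour = ∣∣-witness (≤-trans (≤-reflexive (sym (∣⁅⁆∣ r))) (hall ⁅ r ⁆ r⊆R))
    c : Fin n
    c = proj₁ neighbour
    c∈C : c ∈ C
    c∈C = ∩-elimʳ (proj₂ neighbour)
    rc : T (E r c)
    rc with Γ-elim (∩-elimˡ (proj₂ neighbour))
    ... | i , i∈r , e = subst (λ i → T (E i c)) (sym (⁅⁆-elim i∈r)) e

  -- Beyond a critical set S, Hall's condition holds for R ─ S in the columns
  -- outside Γ S: the neighbours of T ∪ S split into those of S and the new ones of T.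
  hall-beyond-critical : {R S : Sub m} {C : Sub n} → HallCondition R C →
    Critical R C S → HallCondition (R ─ S) (C ─ (Γ S ∩ C))
  hall-beyond-critical {R} {S} {C} hall (S⊆R , _ , _ , tight) T T⊆ = +-cancelˡ-≤ ∣ S ∣ _ _ (begin
    ∣ S ∣ + ∣ T ∣                            ≤⟨ +-mono-≤ (∣∣-mono S⊆U∩S) (∣∣-mono T⊆U─S) ⟩
    ∣ U ∩ S ∣ + ∣ U ─ S ∣                    ≡⟨ sym (∣∣-split S) ⟩
    ∣ U ∣                                    ≤⟨ hall U U⊆R ⟩
    ∣ Γ U ∩ C ∣                              ≡⟨ ∣∣-split (Γ S) ⟩
    ∣ (Γ U ∩ C) ∩ Γ S ∣ + ∣ (Γ U ∩ C) ─ Γ S ∣ ≤⟨ +-mono-≤ (∣∣-mono old) (∣∣-mono new) ⟩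
    ∣ Γ S ∩ C ∣ + ∣ Γ T ∩ (C ─ (Γ S ∩ C)) ∣  ≤⟨ +-monoˡ-≤ _ tight ⟩
    ∣ S ∣ + ∣ Γ T ∩ (C ─ (Γ S ∩ C)) ∣        ∎)
    where
    open ≤-Reasoning
    U : Sub m
    U = T ∪ S
    S⊆U∩S : S ⊆ U ∩ S
    S⊆U∩S x p = ∩-intro (∪-introʳ p) p
    T⊆U─S : T ⊆ U ─ S
    T⊆U─S x p = ─-intro (∪-introˡ p) (─-elimʳ (T⊆ x p))
    U⊆R : U ⊆ R
    U⊆R x p with ∪-elim p
    ... | inj₁ x∈T = ─-elimˡ (T⊆ x x∈T)
    ... | inj₂ x∈S = S⊆R x x∈S
    old : (Γ U ∩ C) ∩ Γ S ⊆ Γ S ∩ C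
    old c p = ∩-intro (∩-elimʳ {S = Γ U ∩ C} p) (∩-elimʳ {S = Γ U} (∩-elimˡ {R = Γ S} p))
    new : (Γ U ∩ C) ─ Γ S ⊆ Γ T ∩ (C ─ (Γ S ∩ C))
    new c p = ∩-intro c∈ΓT (─-intro c∈C (c∉ΓS ∘ ∩-elimˡ))
      where
      c∈ΓU∩C : c ∈ Γ U ∩ C
      c∈ΓU∩C = ─-elimˡ p
      c∉ΓS : c ∉ Γ S
      c∉ΓS = ─-elimʳ p
      c∈C : c ∈ C
      c∈C = ∩-elimʳ c∈ΓU∩C
      c∈ΓT : c ∈ Γ T
      c∈ΓT with Γ-elim (∩-elimˡ c∈ΓU∩C)
      ... | i , i∈U , e with ∪-elim i∈U
      ...   | inj₁ i∈T = Γ-intro i∈T e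
      ...   | inj₂ i∈S = ⊥-elim (c∉ΓS (Γ-intro i∈S e))

  -- A critical set S: match S into C by induction (it only uses Γ S), and the
  -- rest of R into the remaining columns by induction.
  match-critical : {R S : Sub m} {C : Sub n} → HallCondition R C → Smaller R →
    Critical R C S → Matching R C
  match-critical {R} {S} {C} hall smaller critical@(S⊆R , (x , x∈S) , (y , y∈R , y∉S) , _) =
    glue S (Γ S ∩ C) (λ _ → ∩-elimʳ)
      (narrow (λ _ → ∩-elimʳ) (smaller S C (∣∣-mono-< S⊆R y∈R y∉S) (hall-mono S⊆R hall)))
      (smaller (R ─ S) _ (∣∣-mono-< (λ _ → ─-elimˡ) (S⊆R x x∈S) (λ p → ─-elimʳ p x∈S))
                         (hall-beyond-critical hall critical))

  step : {R : Sub m} {C : Sub n} → HallCondition R C → Smaller R → Matching R C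
  step {R} {C} hall smaller with any? (_∈? R) | critical? R C
  ... | no noRow | _ = empty-matching (λ i p → noRow (i , p))
  ... | yes _ | yes (S , critical) = match-critical hall smaller critical
  ... | yes (r , r∈R) | no noCritical = match-noncritical hall smaller noCritical r∈R

  hall : (R : Sub m) (C : Sub n) → HallCondition R C → Matching R C
  hall R C = go R C (<-wellFounded ∣ R ∣)
    where
    go : ∀ R C → Acc _<_ ∣ R ∣ → HallCondition R C → Matching R C
    go R C (acc rec) h = step h (λ R′ C′ lt → go R′ C′ (rec lt))

  -- A d-regular bipartite graph (d ≥ 1) satisfies Hall's condition, by counting
  -- the edges leaving S: d ∣ S ∣ of them, all landing in Γ S, at most d per column.
  regular⇒hall : (d : ℕ) .{{_ : NonZero d}} → (∀ i → ∣ E i ∣ ≡ d) → (∀ c → ∣ column c ∣ ≡ d) →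
    HallCondition full full
  regular⇒hall d rowDegree columnDegree S _ =
    ≤-trans (*-cancelʳ-≤ ∣ S ∣ ∣ Γ S ∣ d edges) (∣∣-mono (λ c p → ∩-intro p (mem tt)))
    where
    open ≤-Reasoning
    edges : ∣ S ∣ * d ≤ ∣ Γ S ∣ * d
    edges = begin
      ∣ S ∣ * d                            ≡⟨ ∣∣-*-as-sum S d ⟩
      sum (λ i → ind (S i) * d)            ≡⟨ sum-cong-≗ out-degree ⟩
      sum (λ i → ∣ (λ c → S i ∧ E i c) ∣)  ≡⟨ double-count (λ i c → S i ∧ E i c) ⟩
      sum (λ c → ∣ S ∩ column c ∣)         ≤⟨ sum-mono _ _ in-degree ⟩
      sum (λ c → ind (Γ S c) * d)          ≡⟨ ∣∣-*-as-sum (Γ S) d ⟨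
      ∣ Γ S ∣ * d                          ∎
      where
      out-degree : ∀ i → ind (S i) * d ≡ ∣ (λ c → S i ∧ E i c) ∣
      out-degree i = trans (cong (ind (S i) *_) (sym (rowDegree i))) (ind-*-∣∣ (S i) (E i))
      in-degree : ∀ c → ∣ S ∩ column c ∣ ≤ ind (Γ S c) * d
      in-degree c = ∣∣-gated (≤-trans (∣∣-mono (λ _ → ∩-elimʳ)) (≤-reflexive (columnDegree c)))

open Hall using (Matching; column; hall; regular⇒hall)

-- An injection Fin n → Fin n is onto: a map missing c would, after closing the
-- gap at c, inject Fin n into Fin (n - 1).
injective⇒surjective : {f : Fin n → Fin n} → Injective _≡_ _≡_ f → ∀ c → ∃ λ i → f i ≡ c
injective⇒surjective {suc n} {f} inj c with any? (λ i → f i Fin.≟ c)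
... | yes hit = hit
... | no miss = contradiction (injective⇒≤ avoid-injective) 1+n≰n
  where
  avoid : Fin (suc n) → Fin n
  avoid i = punchOut {i = c} (λ c≡fi → miss (i , sym c≡fi))
  avoid-injective : Injective _≡_ _≡_ avoid
  avoid-injective eq = inj (punchOut-injective {i = c} _ _ eq)

injection⇒permutation : (f : Fin n → Fin n) → Injective _≡_ _≡_ f → Permutation′ n
injection⇒permutation f inj = mk↔ₛ′ f (proj₁ ∘ onto) (proj₂ ∘ onto) (λ i → inj (proj₂ (onto (f i))))
  where
  onto : ∀ c → ∃ λ i → f i ≡ c
  onto = injective⇒surjective inj

RowLatin : (Fin m → Fin n → ℕ) → Set
RowLatin A = ∀ i j k → A i j ≡ A i k → j ≡ k

transpose : (Fin m → Fin n → ℕ) → Fin n → Fin m → ℕ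
transpose A j i = A i j

cells : (Fin m → Fin n → ℕ) → ℕ → Fin m → Sub n
cells A s i j = ⌊ A i j ℕ.≟ s ⌋

rows-of : (Fin m → Fin n → ℕ) → ℕ → Sub m
rows-of A s i = nonempty (cells A s i)

count : (Fin m → Fin n → ℕ) → ℕ → ℕ
count A s = sum (λ i → ∣ cells A s i ∣)

count-transpose : (A : Fin m → Fin n → ℕ) (s : ℕ) → count A s ≡ count (transpose A) s
count-transpose A s = double-count (cells A s)

occ≡count : (A : Square n) (s : ℕ) → occ A s ≡ count A s
occ≡count {n} A s = trans (sum-allFin (λ i → list-sum (List.map (cell i) (List.allFin n))))
  (sum-cong-≗ (λ i → trans (sum-allFin (cell i)) (sym (∣∣-as-sum (cells A s i)))))
  where
  cell : Fin n → Fin n → ℕ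
  cell i j = ind ⌊ A i j ℕ.≟ s ⌋
  sum-tabulate : ∀ {k} (f : Fin k → ℕ) → list-sum (List.tabulate f) ≡ sum f
  sum-tabulate {zero} f = refl
  sum-tabulate {suc k} f = cong (f zero +_) (sum-tabulate (f ∘ suc))
  sum-allFin : (f : Fin n → ℕ) → list-sum (List.map f (List.allFin n)) ≡ sum f
  sum-allFin f = trans (cong list-sum (map-tabulate id f)) (sum-tabulate f)

module _ {A : Fin m → Fin n → ℕ} (latin : RowLatin A) {s : ℕ} where

  -- A symbol occurs at most once in each row, so it occurs as often as the
  -- number of rows containing it.
  count≡∣rows-of∣ : count A s ≡ ∣ rows-of A s ∣
  count≡∣rows-of∣ = trans (sum-cong-≗ (λ i → ∣∣-atMostOne (once-per-row i)))
                          (sym (∣∣-as-sum (rows-of A s)))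
    where
    once-per-row : ∀ i → AtMostOne (cells A s i)
    once-per-row i j k (mem p) (mem q) = latin i j k (trans (toWitness p) (sym (toWitness q)))

  in-row : ∀ {i j} → A i j ≡ s → i ∈ rows-of A s
  in-row e = mem (nonempty-intro (mem (fromWitness e)))

  in-every-row : count A s ≡ m → ∀ i → ∃ λ j → A i j ≡ s
  in-every-row total i with nonempty-elim (holds (∣∣≡n⇒full (trans (sym count≡∣rows-of∣) total) i))
  ... | j , mem p = j , toWitness p

  single-row : count A s ≡ 1 → ∀ {i i′ j j′} → A i j ≡ s → A i′ j′ ≡ s → i ≡ i′
  single-row once e e′ =
    ∣∣≤1⇒atMostOne (≤-reflexive (trans (sym count≡∣rows-of∣) once)) _ _ (in-row e) (in-row e′)

  some-cell : count A s ≡ 1 → ∃ λ i → ∃ λ j → A i j ≡ s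
  some-cell once with ∣∣-witness (≤-reflexive (trans (sym once) count≡∣rows-of∣))
  ... | i , i∈rows with nonempty-elim (holds i∈rows)
  ...   | j , mem p = i , j , toWitness p

-- Let F mark some symbols, each of which (when it occurs) occurs in every column.
-- Then a row of a row-Latin array has at most as many F-cells as any column:
-- send each F-cell of row i to the cell of column j with the same symbol.
F-row≤F-column : (A : Fin m → Fin n → ℕ) (F : ℕ → Bool) → RowLatin A →
  (∀ i k → T (F (A i k)) → ∀ j → ∃ λ r → A r j ≡ A i k) →
  ∀ i j → ∣ (λ k → F (A i k)) ∣ ≤ ∣ (λ r → F (A r j)) ∣
F-row≤F-column A F latin spread i j = ∣∣-injection _ _ row-of into injective
  where
  row-of : ∀ k → k ∈ (λ k → F (A i k)) → Fin _
  row-of k (mem p) = proj₁ (spread i k p j)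
  same : ∀ k p → A (row-of k p) j ≡ A i k
  same k (mem p) = proj₂ (spread i k p j)
  into : ∀ k p → row-of k p ∈ (λ r → F (A r j))
  into k p = mem (subst (T ∘ F) (sym (same k p)) (holds p))
  injective : ∀ k k′ p q → row-of k p ≡ row-of k′ q → k ≡ k′
  injective k k′ p q e =
    latin i k k′ (trans (sym (same k p)) (trans (cong (λ r → A r j) e) (same k′ q)))

module Transversal {n : ℕ} (A : Square n) (latin : IsGenLatin A)
  (one-or-n : ∀ s → Occurs A s → occ A s ≡ 1 ⊎ occ A s ≡ n) where

  row-latin : RowLatin A
  row-latin = proj₁ latin

  column-latin : RowLatin (transpose A)
  column-latin j i i′ = proj₂ latin i i′ j

  E : Fin n → Fin n → Bool
  E i j = ⌊ occ A (A i j) ℕ.≟ 1 ⌋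

  n-times : ∀ i k → T (not (E i k)) → occ A (A i k) ≡ n
  n-times i k not-single with one-or-n (A i k) (i , k , refl)
  ... | inj₁ once = contradiction (fromWitness once) (T-not⇒¬T _ not-single)
  ... | inj₂ n-occurrences = n-occurrences

  spread-columns : ∀ i k → T (not (E i k)) → ∀ j → ∃ λ r → A r j ≡ A i k
  spread-columns i k not-single = in-every-row column-latin {A i k} (begin
    count (transpose A) (A i k)  ≡⟨ count-transpose A (A i k) ⟨
    count A (A i k)              ≡⟨ occ≡count A (A i k) ⟨
    occ A (A i k)                ≡⟨ n-times i k not-single ⟩
    n                            ∎)
    where open ≡-Reasoning

  spread-rows : ∀ k i → T (not (E i k)) → ∀ j → ∃ λ r → A j r ≡ A i k
  spread-rows k i not-single = in-every-row row-latin {A i k}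
    (trans (sym (occ≡count A (A i k))) (n-times i k not-single))

  -- All rows and columns contain equally many singleton cells, since their
  -- complements agree by F-row≤F-column in both orientations.
  degree : ∀ i j → ∣ E i ∣ ≡ ∣ column E j ∣
  degree i j = +-cancelʳ-≡ ∣ full ─ E i ∣ _ _ (begin
    ∣ E i ∣ + ∣ full ─ E i ∣                   ≡⟨ ∣∣+∣∁∣ (E i) ⟩
    n                                          ≡⟨ ∣∣+∣∁∣ (column E j) ⟨
    ∣ column E j ∣ + ∣ full ─ column E j ∣     ≡⟨ cong (∣ column E j ∣ +_) complements ⟨
    ∣ column E j ∣ + ∣ full ─ E i ∣            ∎)
    where
    open ≡-Reasoning
    F : ℕ → Bool
    F s = not ⌊ occ A s ℕ.≟ 1 ⌋
    complements : ∣ full ─ E i ∣ ≡ ∣ full ─ column E j ∣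
    complements = ≤-antisym (F-row≤F-column A F row-latin spread-columns i j)
                            (F-row≤F-column (transpose A) F column-latin spread-rows j i)

  -- Given one singleton symbol, the graph is d-regular with d ≥ 1, so by Hall's
  -- theorem every row is matched to a distinct column through a singleton cell.
  perfect-matching : (∃[ s ] occ A s ≡ 1) → Matching E full full
  perfect-matching (s , once) with some-cell row-latin (trans (sym (occ≡count A s)) once)
  ... | i₀ , j₀ , e = hall E full full (regular⇒hall E d row-degree (λ j → sym (degree i₀ j)))
    where
    d : ℕ
    d = ∣ E i₀ ∣
    instance
      d-nonzero : NonZero d
      d-nonzero = >-nonZero (∣∣-pos (mem {S = E i₀} (fromWitness (trans (cong (occ A) e) once))))
    row-degree : ∀ i → ∣ E i ∣ ≡ d
    row-degree i = trans (degree i j₀) (sym (degree i₀ j₀))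

lemma3 : (n : ℕ) (A : Square n) → IsGenLatin A
    → (∀ s → Occurs A s → occ A s ≡ 1 ⊎ occ A s ≡ n)
    → (∃[ s ] occ A s ≡ 1) → (∃[ s ] occ A s ≡ n)
    → HasTransversal A
lemma3 n A latin one-or-n singleton _ = injection⇒permutation f f-injective , symbols-distinct
  where
  open Transversal A latin one-or-n
  open Matching (perfect-matching singleton)
  f : Fin n → Fin n
  f i = partner i (mem tt)
  f-injective : Injective _≡_ _≡_ f
  f-injective = injective _ _ _ _
  -- The cells (i , f i) hold singleton symbols, which are therefore distinct.
  symbols-distinct : Injective _≡_ _≡_ (λ i → A i (f i))
  symbols-distinct {i} same = single-row row-latin
    (trans (sym (occ≡count A (A i (f i)))) (toWitness (adjacent i (mem tt)))) refl (sym same)
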